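{- Let $\mathcal S\subseteq\mathcal V$ be nonempty. Let $\mathcal M^{\mathcal S}=\{M\in\mathcal M\mid M\rhd_\beta^* N\text{ for some }N\text{ with }FV(N)\subseteq\mathcal S\}$ and let $\mathcal I_{\mathcal S}:\mathcal A\to\mathcal P(\mathcal M)$ be given by $\mathcal I_{\mathcal S}(a)=\mathcal M^{\mathcal S}$ for all $a\in\mathcal A$. Then: (1) $\mathcal I_{\mathcal S}$ is a $\beta$-interpretation (i.e. each $\mathcal I_{\mathcal S}(a)$ is $\beta$-saturated); extend it to $\mathbb U$ as for any $\beta$-interpretation; (2) if $U\in\mathbb U^+$ then $\mathcal I_{\mathcal S}(U)\subseteq\mathcal M^{\mathcal S}$; (3) if $U\in\mathbb U^-$ then $\mathcal M^{\mathcal S}\subseteq\mathcal I_{\mathcal S}(U)$.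
   Context: Terms: $\mathcal V$ is a denumerably infinite set of variables; $\mathcal M$ is the set of untyped $\lambda$-terms $M::=x\mid \lambda x.M\mid MM$ taken modulo $\alpha$-conversion; $FV(M)$ is the set of free variables. $\rhd_\beta$ is the compatible closure of $(\lambda x.M)N\rhd_\beta M[x:=N]$ and $\rhd_\beta^*$ its reflexive-transitive closure. Types: $\mathcal A$ is a denumerably infinite set of atomic types; $\mathbb T::=a\mid \mathbb U\to\mathbb T$ ($a\in\mathcal A$) and $\mathbb U::=\omega\mid \mathbb U\sqcap\mathbb U\mid \mathbb T$; types are quotiented by commutativity, associativity and idempotence of $\sqcap$ and by $\omega\sqcap U=U$. The subsets $\mathbb U^+,\mathbb U^-\subseteq\mathbb U$ are defined simultaneously: every $a\in\mathcal A$ is in both; $\omega\in\mathbb U^-$; if $U\in\mathbb U^+$ then $U\sqcap V\in\mathbb U^+$ (any $V$); if $U,V\in\mathbb U^-$ then $U\sqcap V\in\mathbb U^-$; if $U\in\mathbb U^-$ and $T\in\mathbb U^+$ (with $T\in\mathbb T$) then $U\to T\in\mathbb U^+$; if $U\in\mathbb U^+$ and $T\in\mathbb U^-$ then $U\to T\in\mathbb U^-$. Semantics: for $\mathcal X,\mathcal Y\subseteq\mathcal M$, $\mathcal X\leadsto\mathcal Y=\{M\in\mathcal M\mid MN\in\mathcal Y\text{ for all }N\in\mathcal X\}$. $\mathcal X$ is $\beta$-saturated if $M\rhd_\beta^*N$ and $N\in\mathcal X$ imply $M\in\mathcal X$. A $\beta$-interpretation is a function $\mathcal I:\mathcal A\to\mathcal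 P(\mathcal M)$ with every $\mathcal I(a)$ $\beta$-saturated, extended to $\mathbb U$ by $\mathcal I(\omega)=\mathcal M$, $\mathcal I(U_1\sqcap U_2)=\mathcal I(U_1)\cap\mathcal I(U_2)$, $\mathcal I(U\to T)=\mathcal I(U)\leadsto\mathcal I(T)$. -}

module Defs where

open import Data.Nat using (ℕ; zero; suc)
open import Data.Unit using (⊤)
open import Data.Product using (Σ; ∃; _×_; _,_)
open import Level using (0ℓ)
open import Relation.Unary using (Pred; _⊆_; _∩_; U)
open import Relation.Binary.Construct.Closure.ReflexiveTransitive using (Star)

-- Untyped λ-terms modulo α-conversion: de Bruijn representation.
-- Variables 𝒱 = ℕ; a free variable x occurring under k binders is
-- represented by the index k + x.

data Term : Set where
  var : ℕ → Term
  lam : Term → Term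
  app : Term → Term → Term

ext : (ℕ → ℕ) → ℕ → ℕ
ext ρ zero    = zero
ext ρ (suc n) = suc (ρ n)

rename : (ℕ → ℕ) → Term → Term
rename ρ (var x)   = var (ρ x)
rename ρ (lam M)   = lam (rename (ext ρ) M)
rename ρ (app M N) = app (rename ρ M) (rename ρ N)

exts : (ℕ → Term) → ℕ → Term
exts σ zero    = var zero
exts σ (suc n) = rename suc (σ n)

subst : (ℕ → Term) → Term → Term
subst σ (var x)   = σ x
subst σ (lam M)   = lam (subst (exts σ) M)
subst σ (app M N) = app (subst σ M) (subst σ N)

σ₀ : Term → ℕ → Term
σ₀ N zero    = N
σ₀ N (suc n) = var n

-- M [ N ] is M[x:=N] where x is the variable bound by the outer λ of λx.M
_[_] : Term → Term → Term
M [ N ] = subst (σ₀ N) M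

data _▷β_ : Term → Term → Set where
  β    : ∀ {M N} → app (lam M) N ▷β (M [ N ])
  ξlam : ∀ {M M'} → M ▷β M' → lam M ▷β lam M'
  ξappˡ : ∀ {M M' N} → M ▷β M' → app M N ▷β app M' N
  ξappʳ : ∀ {M N N'} → N ▷β N' → app M N ▷β app M N'

_▷β*_ : Term → Term → Set
_▷β*_ = Star _▷β_

liftSet : Pred ℕ 0ℓ → Pred ℕ 0ℓ
liftSet S zero    = ⊤
liftSet S (suc n) = S n

FV⊆ : Term → Pred ℕ 0ℓ → Set
FV⊆ (var x)   S = S x
FV⊆ (lam M)   S = FV⊆ M (liftSet S)
FV⊆ (app M N) S = FV⊆ M S × FV⊆ N S

MS : Pred ℕ 0ℓ → Pred Term 0ℓ
MS S M = ∃ λ N → (M ▷β* N) × FV⊆ N S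

-- Types. Atomic types 𝒜 = ℕ. Raw syntax for 𝕋 and 𝕌, with the
-- equivalence generated by ACI of ⊓ and ω ⊓ U = U.

infixr 7 _⇒_
infixl 8 _⊓_

mutual
  data Ty : Set where
    atom : ℕ → Ty
    _⇒_  : UTy → Ty → Ty

  data UTy : Set where
    ω   : UTy
    _⊓_ : UTy → UTy → UTy
    ⌜_⌝ : Ty → UTy

mutual
  data _≈T_ : Ty → Ty → Set where
    ≈T-refl  : ∀ {T} → T ≈T T
    ≈T-sym   : ∀ {T T'} → T ≈T T' → T' ≈T T
    ≈T-trans : ∀ {T T' T''} → T ≈T T' → T' ≈T T'' → T ≈T T''
    ⇒-cong   : ∀ {U U' T T'} → U ≈U U' → T ≈T T' → (U ⇒ T) ≈T (U' ⇒ T')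

  data _≈U_ : UTy → UTy → Set where
    ≈U-refl  : ∀ {U} → U ≈U U
    ≈U-sym   : ∀ {U U'} → U ≈U U' → U' ≈U U
    ≈U-trans : ∀ {U U' U''} → U ≈U U' → U' ≈U U'' → U ≈U U''
    ⊓-cong   : ∀ {U U' V V'} → U ≈U U' → V ≈U V' → (U ⊓ V) ≈U (U' ⊓ V')
    ⌜⌝-cong  : ∀ {T T'} → T ≈T T' → ⌜ T ⌝ ≈U ⌜ T' ⌝
    ⊓-comm   : ∀ {U V} → (U ⊓ V) ≈U (V ⊓ U)
    ⊓-assoc  : ∀ {U V W} → ((U ⊓ V) ⊓ W) ≈U (U ⊓ (V ⊓ W))
    ⊓-idem   : ∀ {U} → (U ⊓ U) ≈U U
    ω-unit   : ∀ {U} → (ω ⊓ U) ≈U U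

-- 𝕌⁺ and 𝕌⁻ (closed under the type equivalence, as types are quotiented)
mutual
  data Pos : UTy → Set where
    atom⁺ : ∀ a → Pos ⌜ atom a ⌝
    ⊓⁺    : ∀ {U} V → Pos U → Pos (U ⊓ V)
    ⇒⁺    : ∀ {U T} → Neg U → Pos ⌜ T ⌝ → Pos ⌜ U ⇒ T ⌝
    ≈⁺    : ∀ {U V} → U ≈U V → Pos U → Pos V

  data Neg : UTy → Set where
    atom⁻ : ∀ a → Neg ⌜ atom a ⌝
    ω⁻    : Neg ω
    ⊓⁻    : ∀ {U V} → Neg U → Neg V → Neg (U ⊓ V)
    ⇒⁻    : ∀ {U T} → Pos U → Neg ⌜ T ⌝ → Neg ⌜ U ⇒ T ⌝
    ≈⁻    : ∀ {U V} → U ≈U V → Neg U → Neg V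

_⇝_ : Pred Term 0ℓ → Pred Term 0ℓ → Pred Term 0ℓ
(X ⇝ Y) M = ∀ N → X N → Y (app M N)

βSaturated : Pred Term 0ℓ → Set
βSaturated X = ∀ {M N} → M ▷β* N → X N → X M

Interp : Set₁
Interp = ℕ → Pred Term 0ℓ

IsβInterp : Interp → Set
IsβInterp I = ∀ a → βSaturated (I a)

mutual
  ⟦_⟧T : Ty → Interp → Pred Term 0ℓ
  ⟦ atom a ⟧T I = I a
  ⟦ U ⇒ T ⟧T I = ⟦ U ⟧U I ⇝ ⟦ T ⟧T I

  ⟦_⟧U : UTy → Interp → Pred Term 0ℓ
  ⟦ ω ⟧U I = U
  ⟦ U₁ ⊓ U₂ ⟧U I = ⟦ U₁ ⟧U I ∩ ⟦ U₂ ⟧U I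
  ⟦ ⌜ T ⌝ ⟧U I = ⟦ T ⟧T I

IS : Pred ℕ 0ℓ → Interp
IS S a = MS S

module Submission where

-- Fix a variable x ∈ S.  Every set 𝓜^S is β-saturated (a
-- reduction sequence can be prefixed by another one), so 𝓘_S is a
-- β-interpretation.  Parts (2) and (3) are proved by a simultaneous
-- induction on the derivations of U ∈ 𝕌⁺ and U ∈ 𝕌⁻:
--   * for U → T negative, if M, N ∈ 𝓜^S then M N ∈ 𝓜^S, because
--     𝓜^S is closed under application;
--   * for U → T positive, the variable x lies in 𝓜^S ⊆ 𝓘_S(U), so
--     M x ∈ 𝓘_S(T) ⊆ 𝓜^S, and the key lemma below shows that
--     M x ∈ 𝓜^S implies M ∈ 𝓜^S when x ∈ S;
--   * the closure of 𝕌± under type equivalence is handled by the fact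
--     that equivalent types have equal interpretations.

open import Defs
open import Data.Nat using (ℕ; zero; suc)
open import Data.Product using (∃; _×_; _,_; proj₁; proj₂)
open import Data.Unit using (tt)
open import Level using (0ℓ)
open import Relation.Unary using (Pred; _⊆_; _⊆′_; _≐_)
open import Relation.Unary.Properties using (≐-refl; ≐-sym; ≐-trans)
open import Relation.Binary.PropositionalEquality
  using (_≡_; refl; sym; trans; cong; cong₂; module ≡-Reasoning)
open import Relation.Binary.Construct.Closure.ReflexiveTransitive
  using (ε; _◅_; _◅◅_; gmap)

rename-cong : ∀ {ρ ρ'} → (∀ n → ρ n ≡ ρ' n) → ∀ M → rename ρ M ≡ rename ρ' M
rename-cong e (var x)   = cong var (e x)
rename-cong e (lam M)   = cong lam (rename-cong ext-cong M)
  where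
  ext-cong : ∀ n → ext _ n ≡ ext _ n
  ext-cong zero    = refl
  ext-cong (suc n) = cong suc (e n)
rename-cong e (app M N) = cong₂ app (rename-cong e M) (rename-cong e N)

subst-cong : ∀ {σ τ} → (∀ n → σ n ≡ τ n) → ∀ M → subst σ M ≡ subst τ M
subst-cong e (var x)   = e x
subst-cong e (lam M)   = cong lam (subst-cong exts-cong M)
  where
  exts-cong : ∀ n → exts _ n ≡ exts _ n
  exts-cong zero    = refl
  exts-cong (suc n) = cong (rename suc) (e n)
subst-cong e (app M N) = cong₂ app (subst-cong e M) (subst-cong e N)

rename-rename : ∀ ρ ρ' M → rename ρ (rename ρ' M) ≡ rename (λ n → ρ (ρ' n)) M
rename-rename ρ ρ' (var x)   = refl
rename-rename ρ ρ' (lam M)   =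
  cong lam (trans (rename-rename (ext ρ) (ext ρ') M) (rename-cong ext-comp M))
  where
  ext-comp : ∀ n → ext ρ (ext ρ' n) ≡ ext (λ k → ρ (ρ' k)) n
  ext-comp zero    = refl
  ext-comp (suc n) = refl
rename-rename ρ ρ' (app M N) = cong₂ app (rename-rename ρ ρ' M) (rename-rename ρ ρ' N)

rename-subst : ∀ ρ σ M → rename ρ (subst σ M) ≡ subst (λ n → rename ρ (σ n)) M
rename-subst ρ σ (var x)   = refl
rename-subst ρ σ (lam M)   =
  cong lam (trans (rename-subst (ext ρ) (exts σ) M) (subst-cong exts-comp M))
  where
  exts-comp : ∀ n → rename (ext ρ) (exts σ n) ≡ exts (λ k → rename ρ (σ k)) n
  exts-comp zero    = refl
  exts-comp (suc n) =
    trans (rename-rename (ext ρ) suc (σ n)) (sym (rename-rename suc ρ (σ n)))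
rename-subst ρ σ (app M N) = cong₂ app (rename-subst ρ σ M) (rename-subst ρ σ N)

subst-rename : ∀ τ ρ M → subst τ (rename ρ M) ≡ subst (λ n → τ (ρ n)) M
subst-rename τ ρ (var x)   = refl
subst-rename τ ρ (lam M)   =
  cong lam (trans (subst-rename (exts τ) (ext ρ) M) (subst-cong exts-comp M))
  where
  exts-comp : ∀ n → exts τ (ext ρ n) ≡ exts (λ k → τ (ρ k)) n
  exts-comp zero    = refl
  exts-comp (suc n) = refl
subst-rename τ ρ (app M N) = cong₂ app (subst-rename τ ρ M) (subst-rename τ ρ N)

subst-by-vars : ∀ ρ σ → (∀ n → σ n ≡ var (ρ n)) → ∀ M → subst σ M ≡ rename ρ M
subst-by-vars ρ σ e (var x)   = e x
subst-by-vars ρ σ e (lam M)   = cong lam (subst-by-vars (ext ρ) (exts σ) exts-vars M)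
  where
  exts-vars : ∀ n → exts σ n ≡ var (ext ρ n)
  exts-vars zero    = refl
  exts-vars (suc n) = cong (rename suc) (e n)
subst-by-vars ρ σ e (app M N) = cong₂ app (subst-by-vars ρ σ e M) (subst-by-vars ρ σ e N)

rename-β : ∀ ρ P Q → rename ρ (P [ Q ]) ≡ (rename (ext ρ) P) [ rename ρ Q ]
rename-β ρ P Q = begin
  rename ρ (subst (σ₀ Q) P)                    ≡⟨ rename-subst ρ (σ₀ Q) P ⟩
  subst (λ n → rename ρ (σ₀ Q n)) P           ≡⟨ subst-cong σ₀-ext P ⟩
  subst (λ n → σ₀ (rename ρ Q) (ext ρ n)) P   ≡⟨ sym (subst-rename (σ₀ (rename ρ Q)) (ext ρ) P) ⟩
  subst (σ₀ (rename ρ Q)) (rename (ext ρ) P)  ∎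
  where
  open ≡-Reasoning
  σ₀-ext : ∀ n → rename ρ (σ₀ Q n) ≡ σ₀ (rename ρ Q) (ext ρ n)
  σ₀-ext zero    = refl
  σ₀-ext (suc n) = refl

-- Renaming reflects one-step reduction: every redex of Pρ comes from a
-- redex of P (renaming cannot create a λ in head position).
rename-reflects-▷β : ∀ ρ P {Q} → rename ρ P ▷β Q →
  ∃ λ P' → (P ▷β P') × (rename ρ P' ≡ Q)
rename-reflects-▷β ρ (var x) ()
rename-reflects-▷β ρ (lam P) (ξlam s) with rename-reflects-▷β (ext ρ) P s
... | P' , s' , refl = lam P' , ξlam s' , refl
rename-reflects-▷β ρ (app (lam P) Q) β = P [ Q ] , β , rename-β ρ P Q
rename-reflects-▷β ρ (app P Q) (ξappˡ s) with rename-reflects-▷β ρ P s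
... | P' , s' , refl = app P' Q , ξappˡ s' , refl
rename-reflects-▷β ρ (app P Q) (ξappʳ s) with rename-reflects-▷β ρ Q s
... | Q' , s' , refl = app P Q' , ξappʳ s' , refl

rename-reflects-▷β* : ∀ ρ P {N} → rename ρ P ▷β* N →
  ∃ λ P' → (P ▷β* P') × (rename ρ P' ≡ N)
rename-reflects-▷β* ρ P ε = P , ε , refl
rename-reflects-▷β* ρ P (s ◅ ss) with rename-reflects-▷β ρ P s
... | P₁ , s₁ , refl with rename-reflects-▷β* ρ P₁ ss
... | P' , ss' , e = P' , s₁ ◅ ss' , e

▷β*-lam : ∀ {M M'} → M ▷β* M' → lam M ▷β* lam M'
▷β*-lam = gmap lam ξlam

▷β*-app : ∀ {M M' N N'} → M ▷β* M' → N ▷β* N' → app M N ▷β* app M' N'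
▷β*-app {M' = M'} {N = N} r r' = gmap (λ t → app t N) ξappˡ r ◅◅ gmap (app M') ξappʳ r'

FV⊆-mono : ∀ M {S T : Pred ℕ 0ℓ} → S ⊆′ T → FV⊆ M S → FV⊆ M T
FV⊆-mono (var x)   S⊆T p       = S⊆T x p
FV⊆-mono (lam M)   S⊆T p       = FV⊆-mono M lift⊆ p
  where
  lift⊆ : liftSet _ ⊆′ liftSet _
  lift⊆ zero    q = q
  lift⊆ (suc n) q = S⊆T n q
FV⊆-mono (app M N) S⊆T (p , q) = FV⊆-mono M S⊆T p , FV⊆-mono N S⊆T q

FV⊆-rename : ∀ M ρ (S : Pred ℕ 0ℓ) → FV⊆ (rename ρ M) S → FV⊆ M (λ n → S (ρ n))
FV⊆-rename (var x)   ρ S p       = p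
FV⊆-rename (lam M)   ρ S p       = FV⊆-mono M lift-preimage (FV⊆-rename M (ext ρ) (liftSet S) p)
  where
  lift-preimage : (λ n → liftSet S (ext ρ n)) ⊆′ liftSet (λ k → S (ρ k))
  lift-preimage zero    q = q
  lift-preimage (suc n) q = q
FV⊆-rename (app M N) ρ S (p , q) = FV⊆-rename M ρ S p , FV⊆-rename N ρ S q

MS-saturated : (S : Pred ℕ 0ℓ) → βSaturated (MS S)
MS-saturated S r (N , r' , fv) = N , r ◅◅ r' , fv

MS-app : (S : Pred ℕ 0ℓ) → ∀ {M N} → MS S M → MS S N → MS S (app M N)
MS-app S (M' , r , fv) (N' , r' , fv') = app M' N' , ▷β*-app r r' , (fv , fv')

instantiate : ℕ → ℕ → ℕ
instantiate x zero    = x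
instantiate x (suc n) = n

β-with-var : ∀ x P → P [ var x ] ≡ rename (instantiate x) P
β-with-var x = subst-by-vars (instantiate x) (σ₀ (var x)) σ₀-var
  where
  σ₀-var : ∀ n → σ₀ (var x) n ≡ var (instantiate x n)
  σ₀-var zero    = refl
  σ₀-var (suc n) = refl

-- Either the reduction stays inside M, or M = λ.P is
-- contracted to P[x], whose reducts all come from reducts P' of P, and
-- FV(λ.P') ⊆ S since P'[x] has its free variables in S.
MS-app-var : (S : Pred ℕ 0ℓ) → ∀ {x} → S x →
  ∀ M {N} → app M (var x) ▷β* N → FV⊆ N S → MS S M
MS-app-var S sx M ε (fv , _) = M , ε , fv
MS-app-var S sx M (ξappˡ s ◅ ss) fv with MS-app-var S sx _ ss fv
... | M' , r , fv' = M' , s ◅ r , fv'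
MS-app-var S sx M (ξappʳ () ◅ ss) fv
MS-app-var S {x} sx (lam P) (β ◅ ss) fv
  rewrite β-with-var x P with rename-reflects-▷β* (instantiate x) P ss
... | P' , r , refl = lam P' , ▷β*-lam r , FV⊆-mono P' unlift (FV⊆-rename P' (instantiate x) S fv)
  where
  unlift : (λ n → S (instantiate x n)) ⊆′ liftSet S
  unlift zero    _ = tt
  unlift (suc n) q = q

mutual
  ⟦⟧T-resp-≈ : ∀ {I T T'} → T ≈T T' → ⟦ T ⟧T I ≐ ⟦ T' ⟧T I
  ⟦⟧T-resp-≈ ≈T-refl          = ≐-refl
  ⟦⟧T-resp-≈ (≈T-sym e)       = ≐-sym (⟦⟧T-resp-≈ e)
  ⟦⟧T-resp-≈ (≈T-trans e e')  = ≐-trans (⟦⟧T-resp-≈ e) (⟦⟧T-resp-≈ e')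
  ⟦⟧T-resp-≈ {I} (⇒-cong {U} {U'} {T} {T'} eU eT) =
    (λ f N n → proj₁ T≐ (f N (proj₂ U≐ n))) , (λ f N n → proj₂ T≐ (f N (proj₁ U≐ n)))
    where
    U≐ : ⟦ U ⟧U I ≐ ⟦ U' ⟧U I
    U≐ = ⟦⟧U-resp-≈ eU
    T≐ : ⟦ T ⟧T I ≐ ⟦ T' ⟧T I
    T≐ = ⟦⟧T-resp-≈ eT

  ⟦⟧U-resp-≈ : ∀ {I U U'} → U ≈U U' → ⟦ U ⟧U I ≐ ⟦ U' ⟧U I
  ⟦⟧U-resp-≈ ≈U-refl         = ≐-refl
  ⟦⟧U-resp-≈ (≈U-sym e)      = ≐-sym (⟦⟧U-resp-≈ e)
  ⟦⟧U-resp-≈ (≈U-trans e e') = ≐-trans (⟦⟧U-resp-≈ e) (⟦⟧U-resp-≈ e')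
  ⟦⟧U-resp-≈ {I} (⊓-cong {U} {U'} {V} {V'} e e') =
    (λ (a , b) → proj₁ U≐ a , proj₁ V≐ b) , (λ (a , b) → proj₂ U≐ a , proj₂ V≐ b)
    where
    U≐ : ⟦ U ⟧U I ≐ ⟦ U' ⟧U I
    U≐ = ⟦⟧U-resp-≈ e
    V≐ : ⟦ V ⟧U I ≐ ⟦ V' ⟧U I
    V≐ = ⟦⟧U-resp-≈ e'
  ⟦⟧U-resp-≈ {I} (⌜⌝-cong e) = ⟦⟧T-resp-≈ {I} e
  ⟦⟧U-resp-≈ ⊓-comm  = (λ (a , b) → b , a) , (λ (a , b) → b , a)
  ⟦⟧U-resp-≈ ⊓-assoc = (λ ((a , b) , c) → a , (b , c)) , (λ (a , (b , c)) → (a , b) , c)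
  ⟦⟧U-resp-≈ ⊓-idem  = proj₁ , (λ a → a , a)
  ⟦⟧U-resp-≈ ω-unit  = proj₂ , (λ a → tt , a)

module Polarity (S : Pred ℕ 0ℓ) {x : ℕ} (x∈S : S x) where

  var-x∈MS : MS S (var x)
  var-x∈MS = var x , ε , x∈S

  mutual
    positive : ∀ U → Pos U → ⟦ U ⟧U (IS S) ⊆ MS S
    positive _ (atom⁺ a)           m       = m
    positive _ (⊓⁺ V p)            (m , _) = positive _ p m
    positive _ (⇒⁺ {U} {T} n p) {M} f
      with positive ⌜ T ⌝ p (f (var x) (negative U n var-x∈MS))
    ... | N , r , fv = MS-app-var S x∈S M r fv
    positive _ (≈⁺ e p)            m       = positive _ p (proj₂ (⟦⟧U-resp-≈ e) m)

    negative : ∀ U → Neg U → MS S ⊆ ⟦ U ⟧U (IS S)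
    negative _ (atom⁻ a)         m     = m
    negative _ ω⁻                m     = tt
    negative _ (⊓⁻ p q)          m     = negative _ p m , negative _ q m
    negative _ (⇒⁻ {U} {T} p q)  m N n = negative ⌜ T ⌝ q (MS-app S m (positive U p n))
    negative _ (≈⁻ e p)          m     = proj₁ (⟦⟧U-resp-≈ e) (negative _ p m)

lemma5p7 : (S : Pred ℕ 0ℓ) → ∃ S →
    IsβInterp (IS S)
    × (∀ U → Pos U → ⟦ U ⟧U (IS S) ⊆ MS S)
    × (∀ U → Neg U → MS S ⊆ ⟦ U ⟧U (IS S))
lemma5p7 S (x , x∈S) = (λ a → MS-saturated S) , positive , negative
  where open Polarity S x∈S
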